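{- Let $G$ be a labeled graph with $n$ vertices and $b$ bad vertices. Then every $12$-representant of $G$ has length at least $n+b$.
   Context: A labeled graph on $n$ vertices has its vertices labeled by distinct integers from $[n]=\{1,\dots,n\}$; vertices are identified with their labels. A word $w$ over $[n]$ is a $12$-representant of $G$ if every letter of $[n]$ occurs at least once in $w$ and, for all $i<j$, the vertices $i$ and $j$ are adjacent in $G$ if and only if there is no occurrence of $i$ in $w$ that precedes an occurrence of $j$. A vertex $y$ of $G$ is bad if there exist vertices $x,z$ with $x<y<z$ such that $xy\notin E(G)$, $yz\notin E(G)$ and $xz\in E(G)$. -}

module Defs where

open import Data.Nat using (ℕ; _<_; _+_)
open import Data.Fin using (Fin; toℕ) renaming (_<_ to _<ᶠ_)
open import Data.Fin.Properties using (_<?_)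
open import Data.Bool using (Bool; true; false; T)
open import Data.List using (List; length; lookup; filter)
open import Data.List.Membership.Propositional using (_∈_)
open import Data.Product using (Σ; ∃; _×_; _,_)
open import Data.Fin.Subset using (Subset)
open import Relation.Binary.PropositionalEquality using (_≡_)
open import Relation.Nullary using (¬_; Dec)

-- A labeled simple graph on n vertices; vertex labels 1..n are represented
-- by Fin n (label k ↔ index k-1; this preserves the order of labels).
record Graph (n : ℕ) : Set where
  field
    adj   : Fin n → Fin n → Bool
    sym   : ∀ i j → adj i j ≡ adj j i
    irrefl : ∀ i → adj i i ≡ false
open Graph public

Edge : ∀ {n} → Graph n → Fin n → Fin n → Set
Edge G i j = T (adj G i j)

Precedes : ∀ {n} → List (Fin n) → Fin n → Fin n → Set
Precedes w i j =
  Σ (Fin (length w)) λ p → Σ (Fin (length w)) λ q →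
    (p <ᶠ q) × (lookup w p ≡ i) × (lookup w q ≡ j)

Is12Representant : ∀ {n} → Graph n → List (Fin n) → Set
Is12Representant {n} G w =
  (∀ (i : Fin n) → i ∈ w) ×
  (∀ (i j : Fin n) → i <ᶠ j → (Edge G i j → ¬ Precedes w i j) × (¬ Precedes w i j → Edge G i j))

Bad : ∀ {n} → Graph n → Fin n → Set
Bad {n} G y = Σ (Fin n) λ x → Σ (Fin n) λ z →
  (x <ᶠ y) × (y <ᶠ z) × ¬ Edge G x y × ¬ Edge G y z × Edge G x z

-- the number of bad vertices is b: given as a list of exactly the bad vertices,
-- without repetition
open import Data.List.Relation.Unary.Unique.Propositional using (Unique)

IsBadSet : ∀ {n} → Graph n → List (Fin n) → Set
IsBadSet {n} G bs = Unique bs × (∀ (y : Fin n) → (y ∈ bs → Bad G y) × (Bad G y → y ∈ bs))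

-- A bad vertex y, witnessed by x < y < z, must occur at least twice in every
-- 12-representant w: the non-edges xy and yz force an occurrence of x before one
-- of y and an occurrence of y before one of z, so if y occurred only once these
-- would chain into an occurrence of x before one of z, contradicting the edge xz.
-- Hence a first occurrence of every vertex together with a second occurrence of
-- every bad vertex gives n + b distinct positions of w.
module Submission where

open import Defs hiding (sym)
open import Data.Nat using (ℕ; _≤_; _+_)
open import Data.Fin using (Fin; zero; suc; join; splitAt; _≟_) renaming (_<_ to _<ᶠ_)
open import Data.Fin.Properties using (any?; injective⇒≤; <-trans; join-splitAt)
open import Data.List using (List; length; lookup; _∷_)
open import Data.List.Membership.Propositional.Properties using (∈-lookup)
open import Data.List.Relation.Unary.Any using (index)
open import Data.List.Relation.Unary.Any.Properties using (lookup-index)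
open import Data.List.Relation.Unary.All as All using ()
open import Data.List.Relation.Unary.AllPairs using (_∷_)
open import Data.List.Relation.Unary.Unique.Propositional using (Unique)
open import Data.Product using (∃; _×_; _,_; proj₁; proj₂)
open import Data.Sum using (_⊎_; inj₁; inj₂)
open import Data.Empty using (⊥-elim)
open import Function using (_∘_)
open import Function.Definitions using (Injective)
open import Relation.Nullary using (¬_; Dec; yes; no)
open import Relation.Nullary.Decidable using (_×-dec_; ¬?)
open import Relation.Binary.PropositionalEquality
  using (_≡_; refl; sym; trans; cong; subst; _≢_; module ≡-Reasoning)

Unique⇒lookup-injective : ∀ {A : Set} {xs : List A} → Unique xs →
  Injective _≡_ _≡_ (lookup xs)
Unique⇒lookup-injective {xs = _ ∷ _} (_  ∷ _) {zero}  {zero}  _ = refl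
Unique⇒lookup-injective {xs = _ ∷ _} (x∉ ∷ _) {zero}  {suc j} e = ⊥-elim (All.lookup x∉ (∈-lookup j) e)
Unique⇒lookup-injective {xs = _ ∷ _} (x∉ ∷ _) {suc i} {zero}  e = ⊥-elim (All.lookup x∉ (∈-lookup i) (sym e))
Unique⇒lookup-injective {xs = _ ∷ _} (_  ∷ u) {suc i} {suc j} e = cong suc (Unique⇒lookup-injective u e)

⊎-injective⇒≤ : ∀ {m n k} {f : Fin m ⊎ Fin n → Fin k} → Injective _≡_ _≡_ f → m + n ≤ k
⊎-injective⇒≤ {m} {n} {f = f} f-inj = injective⇒≤ {f = f ∘ splitAt m} λ {i} {j} e → begin
  i                           ≡⟨ sym (join-splitAt m n i) ⟩
  join m n (splitAt m i)      ≡⟨ cong (join m n) (f-inj e) ⟩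
  join m n (splitAt m j)      ≡⟨ join-splitAt m n j ⟩
  j                           ∎
  where open ≡-Reasoning

module _ {n : ℕ} (w : List (Fin n)) where

  OccursElsewhere : Fin (length w) → Fin n → Set
  OccursElsewhere p y = ∃ λ q → q ≢ p × lookup w q ≡ y

  OccursOnlyAt : Fin (length w) → Fin n → Set
  OccursOnlyAt p y = ∀ q → lookup w q ≡ y → q ≡ p

  occursElsewhere? : ∀ p y → Dec (OccursElsewhere p y)
  occursElsewhere? p y = any? λ q → ¬? (q ≟ p) ×-dec (lookup w q ≟ y)

  ¬OccursElsewhere⇒OccursOnlyAt : ∀ {p y} → ¬ OccursElsewhere p y → OccursOnlyAt p y
  ¬OccursElsewhere⇒OccursOnlyAt {p} ¬e q wq≡y with q ≟ p
  ... | yes q≡p = q≡p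
  ... | no  q≢p = ⊥-elim (¬e (q , q≢p , wq≡y))

  precedes-trans : ∀ {p x y z} → OccursOnlyAt p y →
    Precedes w x y → Precedes w y z → Precedes w x z
  precedes-trans only (a , q , a<q , wa , wq) (q′ , c , q′<c , wq′ , wc) =
    a , c , <-trans a<q q<c , wa , wc
    where
    q<c : q <ᶠ c
    q<c = subst (_<ᶠ c) (trans (only q′ wq′) (sym (only q wq))) q′<c

module _ {n : ℕ} (G : Graph n) (w : List (Fin n)) (R : Is12Representant G w) where

  firstOccurrence : Fin n → Fin (length w)
  firstOccurrence v = index (proj₁ R v)

  lookup-firstOccurrence : ∀ v → lookup w (firstOccurrence v) ≡ v
  lookup-firstOccurrence v = sym (lookup-index (proj₁ R v))

  nonEdge⇒¬¬Precedes : ∀ {i j} → i <ᶠ j → ¬ Edge G i j → ¬ ¬ Precedes w i j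
  nonEdge⇒¬¬Precedes i<j ¬ij ¬Pij = ¬ij (proj₂ (proj₂ R _ _ i<j) ¬Pij)

  edge⇒¬Precedes : ∀ {i j} → i <ᶠ j → Edge G i j → ¬ Precedes w i j
  edge⇒¬Precedes i<j = proj₁ (proj₂ R _ _ i<j)

  bad⇒OccursElsewhere : ∀ {y} p → Bad G y → OccursElsewhere w p y
  bad⇒OccursElsewhere {y} p (x , z , x<y , y<z , ¬xy , ¬yz , xz) with occursElsewhere? w p y
  ... | yes e  = e
  ... | no  ¬e =
    ⊥-elim (nonEdge⇒¬¬Precedes x<y ¬xy λ Pxy → nonEdge⇒¬¬Precedes y<z ¬yz λ Pyz →
      edge⇒¬Precedes (<-trans x<y y<z) xz
        (precedes-trans w (¬OccursElsewhere⇒OccursOnlyAt w ¬e) Pxy Pyz))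

  module _ (bs : List (Fin n)) (B : IsBadSet G bs) where

    secondOccurrence : ∀ k → OccursElsewhere w (firstOccurrence (lookup bs k)) (lookup bs k)
    secondOccurrence k =
      bad⇒OccursElsewhere _ (proj₁ (proj₂ B (lookup bs k)) (∈-lookup k))

    occurrence : Fin n ⊎ Fin (length bs) → Fin (length w)
    occurrence (inj₁ v) = firstOccurrence v
    occurrence (inj₂ k) = proj₁ (secondOccurrence k)

    label : Fin n ⊎ Fin (length bs) → Fin n
    label (inj₁ v) = v
    label (inj₂ k) = lookup bs k

    lookup-occurrence : ∀ s → lookup w (occurrence s) ≡ label s
    lookup-occurrence (inj₁ v) = lookup-firstOccurrence v
    lookup-occurrence (inj₂ k) = proj₂ (proj₂ (secondOccurrence k))

    same-label : ∀ s t → occurrence s ≡ occurrence t → label s ≡ label t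
    same-label s t e =
      trans (sym (lookup-occurrence s)) (trans (cong (lookup w) e) (lookup-occurrence t))

    occurrence-injective : Injective _≡_ _≡_ occurrence
    occurrence-injective {s} {t} e with same-label s t e
    occurrence-injective {inj₁ _} {inj₁ _} e | refl = refl
    occurrence-injective {inj₁ _} {inj₂ k} e | refl = ⊥-elim (proj₁ (proj₂ (secondOccurrence k)) (sym e))
    occurrence-injective {inj₂ k} {inj₁ _} e | refl = ⊥-elim (proj₁ (proj₂ (secondOccurrence k)) e)
    occurrence-injective {inj₂ _} {inj₂ _} _ | k≡ = cong inj₂ (Unique⇒lookup-injective (proj₁ B) k≡)

lemma3p3 : (n : ℕ) (G : Graph n) (bs : List (Fin n)) → IsBadSet G bs →
    (w : List (Fin n)) → Is12Representant G w → n + length bs ≤ length w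
lemma3p3 n G bs B w R = ⊎-injective⇒≤ (occurrence-injective G w R bs B)
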